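{- Let $2\le k\le n$ be integers and let $G$ be a graph on $n$ vertices. Then $bp(G)\le n-k$ if and only if $G$ has a special subgraph of order $k$.
   Context: $bp(G)$ is the minimum number of pairwise edge-disjoint complete bipartite subgraphs (bicliques) of $G$ such that every edge of $G$ lies in exactly one of them. A biclique is a non-star biclique if both of its parts have at least $2$ vertices. An induced subgraph $H$ of $G$ is a special subgraph of order $k$ if, for some integer $r\ge 0$, $H$ has exactly $k+r$ vertices and the edge set of $H$ can be partitioned into the edge sets of at most $r$ non-star bicliques (in particular, an independent set of size $k$ is a special subgraph of order $k$, with $r=0$). -}

module Defs where

open import Data.Nat using (ℕ; _≤_; _+_)
open import Data.Fin using (Fin)
open import Data.Fin.Subset using (Subset; _∈_; _∉_; _⊆_; ∣_∣)
open import Data.Bool using (Bool; true)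
open import Data.Product using (Σ; _×_; ∃)
open import Data.Sum using (_⊎_)
open import Data.Empty using (⊥)
open import Data.Unit using (⊤)
open import Relation.Binary.PropositionalEquality using (_≡_)

record Graph (n : ℕ) : Set where
  field
    adj   : Fin n → Fin n → Bool
    sym   : ∀ u v → adj u v ≡ adj v u
    irrefl : ∀ v → adj v v ≡ true → ⊥

  Edge : Fin n → Fin n → Set
  Edge u v = adj u v ≡ true

open Graph public

record Biclique (n : ℕ) : Set where
  constructor _∣∣_
  field
    left  : Subset n
    right : Subset n

open Biclique public

IsBicliqueOf : ∀ {n} → Graph n → Biclique n → Set
IsBicliqueOf G b =
  (1 ≤ ∣ left b ∣) × (1 ≤ ∣ right b ∣) ×
  (∀ v → v ∈ left b → v ∉ right b) ×
  (∀ a c → a ∈ left b → c ∈ right b → Edge G a c)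

NonStar : ∀ {n} → Biclique n → Set
NonStar b = (2 ≤ ∣ left b ∣) × (2 ≤ ∣ right b ∣)

Covers : ∀ {n} → Biclique n → Fin n → Fin n → Set
Covers b u v = (u ∈ left b × v ∈ right b) ⊎ (u ∈ right b × v ∈ left b)

ExactlyOnce : ∀ {n m} → Graph n → (Fin n → Set) → (Fin m → Biclique n) → Set
ExactlyOnce {n} {m} G P B =
  ∀ u v → P u → P v → Edge G u v →
    (∃ λ i → Covers (B i) u v) × (∀ i j → Covers (B i) u v → Covers (B j) u v → i ≡ j)

BicliquePartition : ∀ {n} → Graph n → (m : ℕ) → (Fin m → Biclique n) → Set
BicliquePartition {n} G m B =
  (∀ i → IsBicliqueOf G (B i)) × ExactlyOnce G (λ _ → ⊤) B

-- bp(G) ≤ t : G has a biclique partition with at most t bicliques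
-- (bp(G) is the minimum such number, so this is exactly "bp(G) ≤ t").
BpAtMost : ∀ {n} → Graph n → ℕ → Set
BpAtMost G t = Σ ℕ λ m → m ≤ t × Σ (Fin m → Biclique _) λ B → BicliquePartition G m B

-- G has a special subgraph of order k: an induced subgraph on a vertex set S with
-- |S| = k + r whose edge set is partitioned into at most r non-star bicliques
-- (bicliques of the induced subgraph G[S], i.e. with parts inside S).
HasSpecialSubgraph : ∀ {n} → Graph n → ℕ → Set
HasSpecialSubgraph {n} G k =
  Σ (Subset n) λ S → Σ ℕ λ r → (∣ S ∣ ≡ k + r) ×
  Σ ℕ λ m → (m ≤ r) × Σ (Fin m → Biclique n) λ B →
    (∀ i → IsBicliqueOf G (B i) × NonStar (B i) × left (B i) ⊆ S × right (B i) ⊆ S) ×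
    ExactlyOnce G (λ v → v ∈ S) B

{-# OPTIONS --safe #-}
-- If bp(G) ≤ n − k, repeatedly take a star of the partition and delete its centre c: every
-- biclique is restricted to the remaining vertices, the star itself disappears, and the
-- invariant k + (number of bicliques) ≤ (number of vertices) is preserved. When no star is
-- left, the remaining vertex set S carries a partition into non-star bicliques, i.e. G[S] is
-- special of order k with r = |S| − k. Conversely, a special subgraph G[S] with its at most
-- r = |S| − k bicliques becomes a partition of G after adding one star per vertex outside S,
-- which gives at most r + (n − |S|) = n − k bicliques.
module Submission where

open import Defs hiding (sym)

open import Data.Nat using (ℕ; suc; _≤_; _<_; _∸_; _+_; s≤s; s≤s⁻¹; _≤?_)
open import Data.Nat.Induction using (<-rec)
open import Data.Nat.Properties
  using (+-comm; +-suc; +-monoʳ-≤; +-mono-≤; ∸-+-assoc; m+[n∸m]≡n; m+n≤o⇒m≤o; m+n≤o⇒m≤o∸n; module ≤-Reasoning)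
open import Data.Bool.Properties using (T-≡)
open import Data.Fin as Fin using (Fin; zero; suc; splitAt; join)
open import Data.Fin.Properties as Finₚ using (suc-injective; all?; ¬∀⟶∃¬; splitAt-join; join-splitAt)
open import Data.Fin.Subset
open import Data.Fin.Subset.Properties
open import Data.Vec using (_∷_; tabulate; lookup; here; there)
open import Data.Bool as Bool using (true)
open import Data.Vec.Functional using (_++_)
open import Data.Vec.Properties using (lookup∘tabulate; []=⇒lookup; lookup⇒[]=)
open import Data.Product as Σ using (∃; ∃₂; _×_; _,_; proj₁; proj₂; map₂)
open import Data.Sum using (_⊎_; inj₁; inj₂; [_,_]′)
open import Data.Empty using (⊥-elim) renaming (⊥ to Void)
open import Function using (_∘_; id)
open import Function.Bundles using (Equivalence; _⇔_; mk⇔)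
open import Function.Definitions using (Injective)
open import Level using (Level)
open import Relation.Nullary using (¬_; Dec; yes; no; does; contradiction)
open import Relation.Nullary.Decidable using (dec-true; toWitness; isYes; isYes≗does; _×-dec_; _⊎-dec_; ¬?)
open import Relation.Unary using (Pred; Decidable)
open import Relation.Binary using (tri<; tri≈; tri>)
open import Relation.Binary.PropositionalEquality

private variable
  ℓ : Level
  n : ℕ

x∈p⇒∣p∣≥1 : ∀ {x} {p : Subset n} → x ∈ p → 1 ≤ ∣ p ∣
x∈p⇒∣p∣≥1 {x = x} {p} x∈p = subst (_≤ ∣ p ∣) (∣⁅x⁆∣≡1 x) (p⊆q⇒∣p∣≤∣q∣ ⁅x⁆⊆p)
  where
  ⁅x⁆⊆p : ⁅ x ⁆ ⊆ p
  ⁅x⁆⊆p y∈⁅x⁆ = subst (_∈ p) (sym (x∈⁅y⁆⇒x≡y x y∈⁅x⁆)) x∈p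

∣p∣≥1⇒Nonempty : (p : Subset n) → 1 ≤ ∣ p ∣ → Nonempty p
∣p∣≥1⇒Nonempty {n} p 1≤∣p∣ with nonempty? p
... | yes p≢∅ = p≢∅
... | no  p≡∅ = contradiction (subst (1 ≤_) ∣p∣≡0 1≤∣p∣) λ ()
  where
  ∣p∣≡0 : ∣ p ∣ ≡ 0
  ∣p∣≡0 = trans (cong ∣_∣ (Empty-unique p≡∅)) (∣⊥∣≡0 n)

x∈p⇒suc∣p-x∣≡∣p∣ : ∀ {x} (p : Subset n) → x ∈ p → suc ∣ p - x ∣ ≡ ∣ p ∣
x∈p⇒suc∣p-x∣≡∣p∣ {x = zero}  (_ ∷ p)       here        = cong (suc ∘ ∣_∣) (p─⊥≡p p)
x∈p⇒suc∣p-x∣≡∣p∣ {x = suc x} (inside ∷ p)  (there x∈p) = cong suc (x∈p⇒suc∣p-x∣≡∣p∣ p x∈p)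
x∈p⇒suc∣p-x∣≡∣p∣ {x = suc x} (outside ∷ p) (there x∈p) = x∈p⇒suc∣p-x∣≡∣p∣ p x∈p

x∈p-y⇒x≢y : ∀ {x y} (p : Subset n) → x ∈ p - y → x ≢ y
x∈p-y⇒x≢y {x = zero}  {zero}   (_ ∷ p) ()          refl
x∈p-y⇒x≢y {x = suc x} {suc .x} (_ ∷ p) (there x∈p) refl = x∈p-y⇒x≢y p x∈p refl

sole-element : (p : Subset n) → 1 ≤ ∣ p ∣ → ¬ 2 ≤ ∣ p ∣ → ∃ λ c → c ∈ p × Empty (p - c)
sole-element p 1≤∣p∣ ∣p∣≱2 with ∣p∣≥1⇒Nonempty p 1≤∣p∣
... | c , c∈p = c , c∈p , λ (x , x∈p-c) →
  ∣p∣≱2 (subst (2 ≤_) (x∈p⇒suc∣p-x∣≡∣p∣ p c∈p) (s≤s (x∈p⇒∣p∣≥1 x∈p-c)))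

Empty[p-x]⇒Empty[p∩[q-x]] : ∀ (p q : Subset n) {x} → Empty (p - x) → Empty (p ∩ (q - x))
Empty[p-x]⇒Empty[p∩[q-x]] p q p-x≡∅ (y , y∈p∩[q-x]) with x∈p∩q⁻ p _ y∈p∩[q-x]
... | y∈p , y∈q-x = p-x≡∅ (y , x∈p∧x≢y⇒x∈p-y y∈p (x∈p-y⇒x≢y q y∈q-x))

select : {P : Pred (Fin n) ℓ} → Decidable P → Subset n
select P? = tabulate (λ x → does (P? x))

module _ {P : Pred (Fin n) ℓ} (P? : Decidable P) where

  ∈-select⁺ : ∀ {x} → P x → x ∈ select P?
  ∈-select⁺ {x} px = lookup⇒[]= x _ (trans (lookup∘tabulate _ x) (dec-true (P? x) px))

  ∈-select⁻ : ∀ {x} → x ∈ select P? → P x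
  ∈-select⁻ {x} x∈ =
    toWitness {a? = P? x} (Equivalence.from T-≡ (begin
      isYes (P? x)                               ≡⟨ isYes≗does (P? x) ⟩
      does (P? x)                                ≡⟨ lookup∘tabulate _ x ⟨
      lookup (tabulate (λ y → does (P? y))) x    ≡⟨ []=⇒lookup x∈ ⟩
      true                                       ∎))
    where open ≡-Reasoning

enumerate : (T : Subset n) → Fin ∣ T ∣ → Fin n
enumerate (inside  ∷ T) zero    = zero
enumerate (inside  ∷ T) (suc x) = suc (enumerate T x)
enumerate (outside ∷ T) x       = suc (enumerate T x)

enumerate-∈ : (T : Subset n) (x : Fin ∣ T ∣) → enumerate T x ∈ T
enumerate-∈ (inside  ∷ T) zero    = here
enumerate-∈ (inside  ∷ T) (suc x) = there (enumerate-∈ T x)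
enumerate-∈ (outside ∷ T) x       = there (enumerate-∈ T x)

enumerate-injective : (T : Subset n) → Injective _≡_ _≡_ (enumerate T)
enumerate-injective (inside  ∷ T) {zero}  {zero}  _  = refl
enumerate-injective (inside  ∷ T) {suc x} {suc y} eq =
  cong suc (enumerate-injective T (suc-injective eq))
enumerate-injective (outside ∷ T)                 eq = enumerate-injective T (suc-injective eq)

enumerate-surjective : (T : Subset n) → ∀ {i} → i ∈ T → ∃ λ x → enumerate T x ≡ i
enumerate-surjective (inside  ∷ T) here        = zero , refl
enumerate-surjective (inside  ∷ T) (there i∈T) with enumerate-surjective T i∈T
... | x , refl = suc x , refl
enumerate-surjective (outside ∷ T) (there i∈T) = map₂ (cong suc) (enumerate-surjective T i∈T)

HasBothParts : Biclique n → Set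
HasBothParts b = 1 ≤ ∣ left b ∣ × 1 ≤ ∣ right b ∣

hasBothParts? : (b : Biclique n) → Dec (HasBothParts b)
hasBothParts? b = (1 ≤? ∣ left b ∣) ×-dec (1 ≤? ∣ right b ∣)

nonStar? : (b : Biclique n) → Dec (NonStar b)
nonStar? b = (2 ≤? ∣ left b ∣) ×-dec (2 ≤? ∣ right b ∣)

_↾_ : Biclique n → Subset n → Biclique n
b ↾ S = (left b ∩ S) ∣∣ (right b ∩ S)

module _ {b : Biclique n} {u v : Fin n} where

  Covers-swap : Covers b u v → Covers b v u
  Covers-swap (inj₁ (u∈L , v∈R)) = inj₂ (v∈R , u∈L)
  Covers-swap (inj₂ (u∈R , v∈L)) = inj₁ (v∈L , u∈R)

  Covers⇒HasBothParts : Covers b u v → HasBothParts b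
  Covers⇒HasBothParts (inj₁ (u∈L , v∈R)) = x∈p⇒∣p∣≥1 u∈L , x∈p⇒∣p∣≥1 v∈R
  Covers⇒HasBothParts (inj₂ (u∈R , v∈L)) = x∈p⇒∣p∣≥1 v∈L , x∈p⇒∣p∣≥1 u∈R

  Covers⇒Edge : (G : Graph n) → IsBicliqueOf G b → Covers b u v → Edge G u v
  Covers⇒Edge G (_ , _ , _ , complete) (inj₁ (u∈L , v∈R)) = complete u v u∈L v∈R
  Covers⇒Edge G (_ , _ , _ , complete) (inj₂ (u∈R , v∈L)) =
    trans (Graph.sym G u v) (complete v u v∈L u∈R)

  Covers⇒∈ : ∀ {S} → left b ⊆ S → right b ⊆ S → Covers b u v → u ∈ S × v ∈ S
  Covers⇒∈ L⊆S R⊆S (inj₁ (u∈L , v∈R)) = L⊆S u∈L , R⊆S v∈R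
  Covers⇒∈ L⊆S R⊆S (inj₂ (u∈R , v∈L)) = R⊆S u∈R , L⊆S v∈L

  Covers-↾⁺ : ∀ {S} → u ∈ S → v ∈ S → Covers b u v → Covers (b ↾ S) u v
  Covers-↾⁺ u∈S v∈S (inj₁ (u∈L , v∈R)) = inj₁ (x∈p∩q⁺ (u∈L , u∈S) , x∈p∩q⁺ (v∈R , v∈S))
  Covers-↾⁺ u∈S v∈S (inj₂ (u∈R , v∈L)) = inj₂ (x∈p∩q⁺ (u∈R , u∈S) , x∈p∩q⁺ (v∈L , v∈S))

  Covers-↾⁻ : ∀ {S} → Covers (b ↾ S) u v → Covers b u v
  Covers-↾⁻ {S} (inj₁ (u∈L , v∈R)) = inj₁ (p∩q⊆p _ S u∈L , p∩q⊆p _ S v∈R)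
  Covers-↾⁻ {S} (inj₂ (u∈R , v∈L)) = inj₂ (p∩q⊆p _ S u∈R , p∩q⊆p _ S v∈L)

star-centre : (b : Biclique n) → HasBothParts b → ¬ NonStar b →
              ∃ λ c → (c ∈ left b ⊎ c ∈ right b) × ∀ S → ¬ HasBothParts (b ↾ (S - c))
star-centre b (1≤∣L∣ , 1≤∣R∣) ¬nonStar with 2 ≤? ∣ left b ∣ | 2 ≤? ∣ right b ∣
... | yes 2≤∣L∣ | yes 2≤∣R∣ = ⊥-elim (¬nonStar (2≤∣L∣ , 2≤∣R∣))
... | no ∣L∣≱2 | _ with sole-element (left b) 1≤∣L∣ ∣L∣≱2
...   | c , c∈L , L-c≡∅ = c , inj₁ c∈L , λ S →
  Empty[p-x]⇒Empty[p∩[q-x]] (left b) S L-c≡∅ ∘ ∣p∣≥1⇒Nonempty _ ∘ proj₁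
star-centre b (1≤∣L∣ , 1≤∣R∣) ¬nonStar | yes _ | no ∣R∣≱2 with sole-element (right b) 1≤∣R∣ ∣R∣≱2
...   | c , c∈R , R-c≡∅ = c , inj₂ c∈R , λ S →
  Empty[p-x]⇒Empty[p∩[q-x]] (right b) S R-c≡∅ ∘ ∣p∣≥1⇒Nonempty _ ∘ proj₂

module _ (G : Graph n) where

  ↾-IsBicliqueOf : ∀ {b} S → IsBicliqueOf G b → HasBothParts (b ↾ S) →
                   IsBicliqueOf G (b ↾ S)
  ↾-IsBicliqueOf S (_ , _ , disjoint , complete) (1≤∣L∣ , 1≤∣R∣) =
    1≤∣L∣ , 1≤∣R∣ ,
    (λ v v∈L v∈R → disjoint v (p∩q⊆p _ S v∈L) (p∩q⊆p _ S v∈R)) ,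
    (λ a c a∈L c∈R → complete a c (p∩q⊆p _ S a∈L) (p∩q⊆p _ S c∈R))

  BicliquePartitionWithin : Subset n → (m : ℕ) → (Fin m → Biclique n) → Set
  BicliquePartitionWithin S m B =
    (∀ i → IsBicliqueOf G (B i) × left (B i) ⊆ S × right (B i) ⊆ S) × ExactlyOnce G (_∈ S) B

  module _ {m : ℕ} (S′ : Subset n) (B : Fin m → Biclique n) where

    survives? : Decidable (λ j → HasBothParts (B j ↾ S′))
    survives? j = hasBothParts? (B j ↾ S′)

    survivors : Subset m
    survivors = select survives?

    restrictFamily : Fin ∣ survivors ∣ → Biclique n
    restrictFamily x = B (enumerate survivors x) ↾ S′

    restrict-partition : ∀ {S} → BicliquePartitionWithin S m B → S′ ⊆ S →
                         BicliquePartitionWithin S′ ∣ survivors ∣ restrictFamily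
    restrict-partition (bicliques , once) S′⊆S = bicliques′ , once′
      where
      bicliques′ : ∀ x → IsBicliqueOf G (restrictFamily x) ×
                         left (restrictFamily x) ⊆ S′ × right (restrictFamily x) ⊆ S′
      bicliques′ x =
        ↾-IsBicliqueOf {b = B j} S′ (proj₁ (bicliques j))
          (∈-select⁻ survives? (enumerate-∈ survivors x)) ,
        p∩q⊆q _ S′ , p∩q⊆q _ S′
        where j = enumerate survivors x

      once′ : ExactlyOnce G (_∈ S′) restrictFamily
      once′ u v u∈S′ v∈S′ uv with once u v (S′⊆S u∈S′) (S′⊆S v∈S′) uv
      ... | (j , j-covers) , unique = covered , λ x y x-covers y-covers →
        enumerate-injective survivors (unique _ _ (Covers-↾⁻ x-covers) (Covers-↾⁻ y-covers))
        where
        j-covers′ : Covers (B j ↾ S′) u v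
        j-covers′ = Covers-↾⁺ u∈S′ v∈S′ j-covers

        covered : ∃ λ x → Covers (restrictFamily x) u v
        covered
          with enumerate-surjective survivors (∈-select⁺ survives? (Covers⇒HasBothParts j-covers′))
        ... | x , x↦j = x , subst (λ j → Covers (B j ↾ S′) u v) (sym x↦j) j-covers′

  delete-star : ∀ {S m B} → BicliquePartitionWithin S m B → (i : Fin m) → ¬ NonStar (B i) →
                ∃ λ c → c ∈ S × ∃₂ λ m′ B′ → m′ < m × BicliquePartitionWithin (S - c) m′ B′
  delete-star {S} {m} {B} partition@(bicliques , _) i ¬nonStar
    with bicliques i
  ... | (1≤∣L∣ , 1≤∣R∣ , _) , L⊆S , R⊆S
    with star-centre (B i) (1≤∣L∣ , 1≤∣R∣) ¬nonStar
  ... | c , c∈B , dies =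
    c , [ L⊆S , R⊆S ]′ c∈B , _ , restrictFamily (S - c) B , fewer ,
    restrict-partition (S - c) B partition (p─q⊆p S ⁅ c ⁆)
    where
    survivors⊆⊤-i : survivors (S - c) B ⊆ ⊤ - i
    survivors⊆⊤-i {j} j∈ = x∈p∧x≢y⇒x∈p-y ∈⊤ λ { refl → dies S (∈-select⁻ (survives? (S - c) B) j∈) }

    fewer : ∣ survivors (S - c) B ∣ < m
    fewer = begin-strict
      ∣ survivors (S - c) B ∣ ≤⟨ p⊆q⇒∣p∣≤∣q∣ survivors⊆⊤-i ⟩
      ∣ ⊤ - i ∣               <⟨ x∈p⇒∣p-x∣<∣p∣ {x = i} {p = ⊤} ∈⊤ ⟩
      ∣ ⊤ {m} ∣               ≡⟨ ∣⊤∣≡n m ⟩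
      m                       ∎
      where open ≤-Reasoning

  special-of-nonStar : ∀ {k S m B} → BicliquePartitionWithin S m B → (∀ i → NonStar (B i)) →
                       k + m ≤ ∣ S ∣ → HasSpecialSubgraph G k
  special-of-nonStar {k} {S} {m} {B} (bicliques , once) nonStar k+m≤∣S∣ =
    S , ∣ S ∣ ∸ k , sym (m+[n∸m]≡n (m+n≤o⇒m≤o k k+m≤∣S∣)) ,
    m , m+n≤o⇒m≤o∸n m (subst (_≤ ∣ S ∣) (+-comm k m) k+m≤∣S∣) ,
    B , bicliques′ , once
    where
    bicliques′ : ∀ i → IsBicliqueOf G (B i) × NonStar (B i) × left (B i) ⊆ S × right (B i) ⊆ S
    bicliques′ i with bicliques i
    ... | biclique , L⊆S , R⊆S = biclique , nonStar i , L⊆S , R⊆S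

  special-from-partition : ∀ k m {S B} → BicliquePartitionWithin S m B → k + m ≤ ∣ S ∣ →
                           HasSpecialSubgraph G k
  special-from-partition k = <-rec Motive step
    where
    Motive : ℕ → Set
    Motive m = ∀ {S B} → BicliquePartitionWithin S m B → k + m ≤ ∣ S ∣ → HasSpecialSubgraph G k

    step : ∀ m → (∀ {m′} → m′ < m → Motive m′) → Motive m
    step m recurse {S} {B} partition k+m≤∣S∣ with all? (λ i → nonStar? (B i))
    ... | yes nonStar = special-of-nonStar partition nonStar k+m≤∣S∣
    ... | no ¬nonStar with ¬∀⟶∃¬ m _ (λ i → nonStar? (B i)) ¬nonStar
    ...   | i , ¬nonStarᵢ with delete-star partition i ¬nonStarᵢ
    ...     | c , c∈S , m′ , B′ , m′<m , partition′ = recurse m′<m partition′ (s≤s⁻¹ (begin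
      suc (k + m′)   ≡⟨ +-suc k m′ ⟨
      k + suc m′     ≤⟨ +-monoʳ-≤ k m′<m ⟩
      k + m          ≤⟨ k+m≤∣S∣ ⟩
      ∣ S ∣          ≡⟨ x∈p⇒suc∣p-x∣≡∣p∣ S c∈S ⟨
      suc ∣ S - c ∣  ∎))
      where open ≤-Reasoning

  bp⇒special : ∀ {k} → k ≤ n → BpAtMost G (n ∸ k) → HasSpecialSubgraph G k
  bp⇒special {k} k≤n (m , m≤n∸k , B , bicliques , once) =
    special-from-partition k m ((λ i → bicliques i , ⊆⊤ , ⊆⊤) , (λ u v _ _ → once u v _ _)) (begin
      k + m          ≤⟨ +-monoʳ-≤ k m≤n∸k ⟩
      k + (n ∸ k)    ≡⟨ m+[n∸m]≡n k≤n ⟩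
      n              ≡⟨ ∣⊤∣≡n n ⟨
      ∣ ⊤ {n} ∣      ∎)
    where open ≤-Reasoning

module _ {m c : ℕ} (G : Graph n) {P : Fin n → Set}
         (B : Fin m → Biclique n) (C : Fin c → Biclique n) where

  ExactlyOnce-++ : (∀ u v → P u → P v → Edge G u v →
                      (∃ λ s → Covers ([ B , C ]′ s) u v) ×
                      (∀ s t → Covers ([ B , C ]′ s) u v → Covers ([ B , C ]′ t) u v → s ≡ t)) →
                   ExactlyOnce G P (B ++ C)
  ExactlyOnce-++ once⊎ u v Pu Pv uv with once⊎ u v Pu Pv uv
  ... | (s , s-covers) , unique =
    (join m c s , subst (λ s → Covers ([ B , C ]′ s) u v) (sym (splitAt-join m c s)) s-covers) ,
    λ i j i-covers j-covers → begin
      i                        ≡⟨ join-splitAt m c i ⟨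
      join m c (splitAt m i)   ≡⟨ cong (join m c) (unique (splitAt m i) (splitAt m j) i-covers j-covers) ⟩
      join m c (splitAt m j)   ≡⟨ join-splitAt m c j ⟩
      j                        ∎
    where open ≡-Reasoning

module _ (G : Graph n) (S : Subset n) where

  -- An edge leaving S goes to the star of an endpoint outside S, the smaller one if both are.
  Leaf : Fin n → Fin n → Set
  Leaf c w = Edge G c w × (w ∈ S ⊎ c Fin.< w)

  leaf? : ∀ c → Decidable (Leaf c)
  leaf? c w = (adj G c w Bool.≟ true) ×-dec ((w ∈? S) ⊎-dec (c Finₚ.<? w))

  starAt : Fin n → Biclique n
  starAt c = ⁅ c ⁆ ∣∣ select (leaf? c)

  IsCentre : Fin n → Set
  IsCentre c = c ∉ S × 1 ≤ ∣ select (leaf? c) ∣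

  centre? : Decidable IsCentre
  centre? c = ¬? (c ∈? S) ×-dec (1 ≤? ∣ select (leaf? c) ∣)

  centres : Subset n
  centres = select centre?

  stars : Fin ∣ centres ∣ → Biclique n
  stars x = starAt (enumerate centres x)

  leaf-asym : ∀ {c c′} → c ∉ S → c′ ∉ S → Leaf c c′ → Leaf c′ c → Void
  leaf-asym c∉S c′∉S (_ , inj₁ c′∈S) _                  = c′∉S c′∈S
  leaf-asym c∉S c′∉S _               (_ , inj₁ c∈S)     = c∉S c∈S
  leaf-asym c∉S c′∉S (_ , inj₂ c<c′) (_ , inj₂ c′<c)    = Finₚ.<-asym c<c′ c′<c

  starAt-IsBicliqueOf : ∀ c → 1 ≤ ∣ select (leaf? c) ∣ → IsBicliqueOf G (starAt c)
  starAt-IsBicliqueOf c 1≤∣leaves∣ =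
    x∈p⇒∣p∣≥1 (x∈⁅x⁆ c) , 1≤∣leaves∣ ,
    (λ v v∈⁅c⁆ v-leaf → irrefl G v (subst (λ c → Edge G c v) (sym (x∈⁅y⁆⇒x≡y c v∈⁅c⁆))
                                           (proj₁ (∈-select⁻ (leaf? c) v-leaf)))) ,
    λ a w a∈⁅c⁆ w-leaf → subst (λ c → Edge G c w) (sym (x∈⁅y⁆⇒x≡y c a∈⁅c⁆))
                                 (proj₁ (∈-select⁻ (leaf? c) w-leaf))

  Covers-starAt⁻ : ∀ {c u v} → Covers (starAt c) u v → (u ≡ c × Leaf c v) ⊎ (v ≡ c × Leaf c u)
  Covers-starAt⁻ {c} (inj₁ (u∈⁅c⁆ , v-leaf)) = inj₁ (x∈⁅y⁆⇒x≡y c u∈⁅c⁆ , ∈-select⁻ (leaf? c) v-leaf)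
  Covers-starAt⁻ {c} (inj₂ (u-leaf , v∈⁅c⁆)) = inj₂ (x∈⁅y⁆⇒x≡y c v∈⁅c⁆ , ∈-select⁻ (leaf? c) u-leaf)

  starAt-centre-unique : ∀ {c c′ u v} → c ∉ S → c′ ∉ S →
                         Covers (starAt c) u v → Covers (starAt c′) u v → c ≡ c′
  starAt-centre-unique c∉S c′∉S c-covers c′-covers
    with Covers-starAt⁻ c-covers | Covers-starAt⁻ c′-covers
  ... | inj₁ (refl , _)     | inj₁ (refl , _)     = refl
  ... | inj₂ (refl , _)     | inj₂ (refl , _)     = refl
  ... | inj₁ (refl , leaf)  | inj₂ (refl , leaf′) = ⊥-elim (leaf-asym c∉S c′∉S leaf leaf′)
  ... | inj₂ (refl , leaf)  | inj₁ (refl , leaf′) = ⊥-elim (leaf-asym c∉S c′∉S leaf leaf′)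

  centre∉S : ∀ x → enumerate centres x ∉ S
  centre∉S x = proj₁ (∈-select⁻ centre? (enumerate-∈ centres x))

  centre-of-edge : ∀ {u v} → Edge G u v → ¬ (u ∈ S × v ∈ S) →
                   (u ∉ S × Leaf u v) ⊎ (v ∉ S × Leaf v u)
  centre-of-edge {u} {v} uv ¬inside with u ∈? S | v ∈? S
  ... | yes u∈S | yes v∈S = ⊥-elim (¬inside (u∈S , v∈S))
  ... | yes u∈S | no  v∉S = inj₂ (v∉S , trans (Graph.sym G v u) uv , inj₁ u∈S)
  ... | no  u∉S | yes v∈S = inj₁ (u∉S , uv , inj₁ v∈S)
  ... | no  u∉S | no  v∉S with Finₚ.<-cmp u v
  ...   | tri< u<v _ _ = inj₁ (u∉S , uv , inj₂ u<v)
  ...   | tri≈ _ refl _ = ⊥-elim (irrefl G u uv)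
  ...   | tri> _ _ v<u = inj₂ (v∉S , trans (Graph.sym G v u) uv , inj₂ v<u)

  leaf⇒centre : ∀ {c w} → c ∉ S → Leaf c w → c ∈ centres
  leaf⇒centre {c} c∉S leaf = ∈-select⁺ centre? (c∉S , x∈p⇒∣p∣≥1 (∈-select⁺ (leaf? c) leaf))

  star-covers-leaf : ∀ {c w} → c ∉ S → Leaf c w → ∃ λ x → Covers (stars x) c w
  star-covers-leaf {c} {w} c∉S leaf with enumerate-surjective centres (leaf⇒centre c∉S leaf)
  ... | x , x↦c =
    x , subst (λ d → Covers (starAt d) c w) (sym x↦c) (inj₁ (x∈⁅x⁆ c , ∈-select⁺ (leaf? c) leaf))

  stars-cover-leaving-edges : ∀ {u v} → Edge G u v → ¬ (u ∈ S × v ∈ S) →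
                              ∃ λ x → Covers (stars x) u v
  stars-cover-leaving-edges uv ¬inside with centre-of-edge uv ¬inside
  ... | inj₁ (u∉S , leaf) = star-covers-leaf u∉S leaf
  ... | inj₂ (v∉S , leaf) = map₂ Covers-swap (star-covers-leaf v∉S leaf)

  stars-avoid-S : ∀ x {u v} → Covers (stars x) u v → ¬ (u ∈ S × v ∈ S)
  stars-avoid-S x covers (u∈S , v∈S) with Covers-starAt⁻ covers
  ... | inj₁ (refl , _) = centre∉S x u∈S
  ... | inj₂ (refl , _) = centre∉S x v∈S

  ∣centres∣≤n∸∣S∣ : ∣ centres ∣ ≤ n ∸ ∣ S ∣
  ∣centres∣≤n∸∣S∣ = subst (∣ centres ∣ ≤_) (∣∁p∣≡n∸∣p∣ S)
    (p⊆q⇒∣p∣≤∣q∣ (λ c∈ → x∉p⇒x∈∁p (proj₁ (∈-select⁻ centre? c∈))))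

  extend-by-stars : ∀ {m B} → BicliquePartitionWithin G S m B →
                    BicliquePartition G (m + ∣ centres ∣) (B ++ stars)
  extend-by-stars {m} {B} (bicliques , once) =
    (λ i → biclique (splitAt m i)) , ExactlyOnce-++ G B stars λ u v _ _ uv → covered uv , unique
    where
    biclique : ∀ s → IsBicliqueOf G ([ B , stars ]′ s)
    biclique (inj₁ j) = proj₁ (bicliques j)
    biclique (inj₂ x) = starAt-IsBicliqueOf _ (proj₂ (∈-select⁻ centre? (enumerate-∈ centres x)))

    B-inside : ∀ j {u v} → Covers (B j) u v → u ∈ S × v ∈ S
    B-inside j = Covers⇒∈ (proj₁ (proj₂ (bicliques j))) (proj₂ (proj₂ (bicliques j)))

    covered : ∀ {u v} → Edge G u v → ∃ λ s → Covers ([ B , stars ]′ s) u v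
    covered {u} {v} uv with (u ∈? S) ×-dec (v ∈? S)
    ... | yes (u∈S , v∈S) = Σ.map inj₁ id (proj₁ (once u v u∈S v∈S uv))
    ... | no  ¬inside     = Σ.map inj₂ id (stars-cover-leaving-edges uv ¬inside)

    unique : ∀ {u v} s t → Covers ([ B , stars ]′ s) u v → Covers ([ B , stars ]′ t) u v → s ≡ t
    unique {u} {v} (inj₁ j) (inj₁ j′) j-covers j′-covers with B-inside j j-covers
    ... | u∈S , v∈S = cong inj₁ (proj₂ (once u v u∈S v∈S (Covers⇒Edge G (proj₁ (bicliques j)) j-covers))
                                        j j′ j-covers j′-covers)
    unique (inj₁ j) (inj₂ x) j-covers x-covers = ⊥-elim (stars-avoid-S x x-covers (B-inside j j-covers))
    unique (inj₂ x) (inj₁ j) x-covers j-covers = ⊥-elim (stars-avoid-S x x-covers (B-inside j j-covers))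
    unique (inj₂ x) (inj₂ y) x-covers y-covers =
      cong inj₂ (enumerate-injective centres
        (starAt-centre-unique (centre∉S x) (centre∉S y) x-covers y-covers))

special⇒bp : ∀ {k} (G : Graph n) → HasSpecialSubgraph G k → BpAtMost G (n ∸ k)
special⇒bp {n} {k} G (S , r , ∣S∣≡k+r , m , m≤r , B , bicliques , once) =
  m + ∣ centres G S ∣ , bound , B ++ stars G S ,
  extend-by-stars G S ((λ i → map₂ proj₂ (bicliques i)) , once)
  where
  k+r≤n : k + r ≤ n
  k+r≤n = subst (_≤ n) ∣S∣≡k+r (∣p∣≤n S)

  bound : m + ∣ centres G S ∣ ≤ n ∸ k
  bound = begin
    m + ∣ centres G S ∣   ≤⟨ +-mono-≤ m≤r (∣centres∣≤n∸∣S∣ G S) ⟩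
    r + (n ∸ ∣ S ∣)       ≡⟨ cong (λ s → r + (n ∸ s)) ∣S∣≡k+r ⟩
    r + (n ∸ (k + r))     ≡⟨ cong (r +_) (∸-+-assoc n k r) ⟨
    r + (n ∸ k ∸ r)       ≡⟨ m+[n∸m]≡n (m+n≤o⇒m≤o∸n r (subst (_≤ n) (+-comm k r) k+r≤n)) ⟩
    n ∸ k                 ∎
    where open ≤-Reasoning

lemma2p1 : (n k : ℕ) → 2 ≤ k → k ≤ n → (G : Graph n) →
    BpAtMost G (n ∸ k) ⇔ HasSpecialSubgraph G k
lemma2p1 n k _ k≤n G = mk⇔ (bp⇒special G k≤n) (special⇒bp G)
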